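{- Every betweenness algebra $\langle A,f,g\rangle$ with at least four elements has a subalgebra (closed under the Boolean operations, $f$ and $g$) isomorphic to the two-element algebra $\langle\{0,1\},f_1,g_1\rangle$ where $f_1(x,y)=1$ iff $x=y=1$ (and $0$ otherwise), and $g_1(x,y)=1$ iff $x=0$ or $y=0$ (so $g_1(1,1)=0$).
   Context: $A$ is a non-trivial Boolean algebra ($+,\cdot,-,0,1$). A PS-algebra has $f:A^2\to A$ with $f(0,y)=f(x,0)=0$ and additive in each argument and $g:A^2\to A$ with $g(0,y)=g(x,0)=1$, $g(x+x',y)=g(x,y)\cdot g(x',y)$, $g(x,y+y')=g(x,y)\cdot g(x,y')$. A betweenness algebra is a PS-algebra satisfying for all $x,y,z$: $x\le f(x,x)$; $f(x,y)\le f(y,x)$; $g(x,y)\le g(y,x)$; $y\cdot f(x,z)\le f(x\cdot f(x,y),z)$; $f(x,g(x,-y)\cdot y)\le y$; and $x\ne0\wedge y\ne0\to g(x,y)\le f(x,y)$. -}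

module Defs where

open import Level using (_⊔_) renaming (suc to lsuc)
open import Data.Bool using (Bool; true; false; not) renaming (_∧_ to _∧ᵇ_; _∨_ to _∨ᵇ_)
open import Data.Product using (Σ; ∃; _×_; _,_)
open import Relation.Nullary using (¬_)
open import Relation.Binary.PropositionalEquality using (_≡_)
open import Algebra.Lattice.Bundles using (BooleanAlgebra)

record BetweennessAlgebra (c ℓ : Level.Level) : Set (lsuc (c ⊔ ℓ)) where
  field
    boolAlg : BooleanAlgebra c ℓ
  open BooleanAlgebra boolAlg public renaming (¬_ to -_)
  _≤_ : Carrier → Carrier → Set ℓ
  x ≤ y = (x ∧ y) ≈ x
  -- x + y is ∨, x · y is ∧, -x is - x, 0 is ⊥, 1 is ⊤
  field
    f g    : Carrier → Carrier → Carrier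
    f-cong : ∀ {x x' y y'} → x ≈ x' → y ≈ y' → f x y ≈ f x' y'
    g-cong : ∀ {x x' y y'} → x ≈ x' → y ≈ y' → g x y ≈ g x' y'
    f-0ˡ   : ∀ y → f ⊥ y ≈ ⊥
    f-0ʳ   : ∀ x → f x ⊥ ≈ ⊥
    f-addˡ : ∀ x x' y → f (x ∨ x') y ≈ (f x y ∨ f x' y)
    f-addʳ : ∀ x y y' → f x (y ∨ y') ≈ (f x y ∨ f x y')
    g-0ˡ   : ∀ y → g ⊥ y ≈ ⊤
    g-0ʳ   : ∀ x → g x ⊥ ≈ ⊤
    g-mulˡ : ∀ x x' y → g (x ∨ x') y ≈ (g x y ∧ g x' y)
    g-mulʳ : ∀ x y y' → g x (y ∨ y') ≈ (g x y ∧ g x y')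
    B1 : ∀ x → x ≤ f x x
    B2 : ∀ x y → f x y ≤ f y x
    B3 : ∀ x y → g x y ≤ g y x
    B4 : ∀ x y z → (y ∧ f x z) ≤ f (x ∧ f x y) z
    B5 : ∀ x y → f x (g x (- y) ∧ y) ≤ y
    B6 : ∀ x y → ¬ (x ≈ ⊥) → ¬ (y ≈ ⊥) → g x y ≤ f x y

-- The two-element algebra ⟨{0,1}, f₁, g₁⟩ on Bool (false = 0, true = 1).
f₁ : Bool → Bool → Bool
f₁ true true = true
f₁ _    _    = false

g₁ : Bool → Bool → Bool
g₁ false _     = true
g₁ _     false = true
g₁ true  true  = false

AtLeastFour : ∀ {c ℓ} → BetweennessAlgebra c ℓ → Set (c ⊔ ℓ)
AtLeastFour A = Σ Carrier λ a → Σ Carrier λ b → Σ Carrier λ c → Σ Carrier λ d →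
  ¬ a ≈ b × ¬ a ≈ c × ¬ a ≈ d × ¬ b ≈ c × ¬ b ≈ d × ¬ c ≈ d
  where open BetweennessAlgebra A

-- A subalgebra of A isomorphic to ⟨{0,1},f₁,g₁⟩: given by an embedding
-- (injective homomorphism for ∨, ∧, ¬, 0, 1, f, g) h : Bool → A;
-- its image is the subalgebra and h is the isomorphism onto it.
record TwoElementSubalgebra {c ℓ} (A : BetweennessAlgebra c ℓ) : Set (c ⊔ ℓ) where
  open BetweennessAlgebra A
  field
    h      : Bool → Carrier
    inj    : ∀ x y → h x ≈ h y → x ≡ y
    h-∨    : ∀ x y → h (x ∨ᵇ y) ≈ (h x ∨ h y)
    h-∧    : ∀ x y → h (x ∧ᵇ y) ≈ (h x ∧ h y)
    h-¬    : ∀ x → h (not x) ≈ (- h x)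
    h-0    : h false ≈ ⊥
    h-1    : h true ≈ ⊤
    h-f    : ∀ x y → h (f₁ x y) ≈ f (h x) (h y)
    h-g    : ∀ x y → h (g₁ x y) ≈ g (h x) (h y)

{-# OPTIONS --safe #-}
module Submission where

-- For nonzero u, axiom B5 at − u puts f (u , g(u,u) − u) below − u; B4 then makes
-- g(u,u) − u disjoint from f(u,u), which contains g(u,u) by B6, so g(u,u) ≤ u.
-- Since g is antitone in each argument, g(1,1) lies below every nonzero element.
-- Three distinct elements a, b, c give the nonzero elements a ⊕ b, a ⊕ c and their
-- sum b ⊕ c, so g(1,1) = 0, while f(1,1) = 1 by B1.
-- Hence {0,1} is closed under f and g, which act on it as f₁ and g₁.

open import Defs
open import Data.Bool using (Bool; true; false; not) renaming (_∧_ to _∧ᵇ_; _∨_ to _∨ᵇ_)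
open import Data.Product using (_,_)
open import Data.Empty using (⊥-elim)
open import Relation.Nullary using (¬_)
open import Relation.Binary.PropositionalEquality using (_≡_) renaming (refl to ≡-refl)
open import Algebra.Bundles using (CommutativeRing)
open import Algebra.Lattice.Bundles using (BooleanAlgebra)
import Algebra.Lattice.Properties.BooleanAlgebra as BooleanAlgebraProperties
import Algebra.Properties.Group as GroupProperties
import Relation.Binary.Reasoning.Setoid as SetoidReasoning

module BooleanAlgebraOrder {c ℓ} (B : BooleanAlgebra c ℓ) where
  open BooleanAlgebra B renaming (¬_ to -_)
  open BooleanAlgebraProperties B
    using (∧-idem; ∧-identityʳ; ∧-zeroˡ; ∧-zeroʳ; ∨-identityʳ; _⊕_; module DefaultXorRing)
  open DefaultXorRing using (⊕-∧-commutativeRing; ⊕-cong; ⊕-inverseʳ; ∧-distribˡ-⊕)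
  open GroupProperties (CommutativeRing.+-group ⊕-∧-commutativeRing)
    using (\\-leftDividesˡ; inverseˡ-unique)
  open SetoidReasoning setoid

  infix 4 _≤_
  _≤_ : Carrier → Carrier → Set ℓ
  x ≤ y = x ∧ y ≈ x

  ≤-trans : ∀ {x y z} → x ≤ y → y ≤ z → x ≤ z
  ≤-trans {x} {y} {z} x≤y y≤z = begin
    x ∧ z        ≈⟨ ∧-cong x≤y refl ⟨
    (x ∧ y) ∧ z  ≈⟨ ∧-assoc x y z ⟩
    x ∧ (y ∧ z)  ≈⟨ ∧-cong refl y≤z ⟩
    x ∧ y        ≈⟨ x≤y ⟩
    x            ∎

  ≈∧⇒≤ : ∀ {x y z} → x ≈ y ∧ z → x ≤ y
  ≈∧⇒≤ {x} {y} {z} x≈y∧z = begin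
    x ∧ y        ≈⟨ ∧-cong x≈y∧z refl ⟩
    (y ∧ z) ∧ y  ≈⟨ ∧-comm (y ∧ z) y ⟩
    y ∧ (y ∧ z)  ≈⟨ ∧-assoc y y z ⟨
    (y ∧ y) ∧ z  ≈⟨ ∧-cong (∧-idem y) refl ⟩
    y ∧ z        ≈⟨ x≈y∧z ⟨
    x            ∎

  ∧-≈⊥⇒≤ : ∀ {x y} → x ∧ - y ≈ ⊥ → x ≤ y
  ∧-≈⊥⇒≤ {x} {y} x∧-y≈⊥ = sym (begin
    x                      ≈⟨ ∧-identityʳ x ⟨
    x ∧ ⊤                  ≈⟨ ∧-cong refl (∨-complementʳ y) ⟨
    x ∧ (y ∨ - y)          ≈⟨ ∧-distribˡ-∨ x y (- y) ⟩
    (x ∧ y) ∨ (x ∧ - y)    ≈⟨ ∨-cong refl x∧-y≈⊥ ⟩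
    (x ∧ y) ∨ ⊥            ≈⟨ ∨-identityʳ (x ∧ y) ⟩
    x ∧ y                  ∎)

  ≤-⇒∧≈⊥ : ∀ {x y} → y ≤ - x → x ∧ y ≈ ⊥
  ≤-⇒∧≈⊥ {x} {y} y≤-x = begin
    x ∧ y          ≈⟨ ∧-cong refl y≤-x ⟨
    x ∧ (y ∧ - x)  ≈⟨ ∧-cong refl (∧-comm y (- x)) ⟩
    x ∧ (- x ∧ y)  ≈⟨ ∧-assoc x (- x) y ⟨
    (x ∧ - x) ∧ y  ≈⟨ ∧-cong (∧-complementʳ x) refl ⟩
    ⊥ ∧ y          ≈⟨ ∧-zeroˡ y ⟩
    ⊥              ∎

  ⊤≈⊥⇒≈ : ⊤ ≈ ⊥ → ∀ x y → x ≈ y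
  ⊤≈⊥⇒≈ ⊤≈⊥ x y = trans (≈⊥ x) (sym (≈⊥ y))
    where
    ≈⊥ : ∀ z → z ≈ ⊥
    ≈⊥ z = trans (sym (∧-identityʳ z)) (trans (∧-cong refl ⊤≈⊥) (∧-zeroʳ z))

  ≤⊕⇒≈⊥ : ∀ {x u v} → x ≤ u → x ≤ v → x ≤ u ⊕ v → x ≈ ⊥
  ≤⊕⇒≈⊥ {x} {u} {v} x≤u x≤v x≤u⊕v = begin
    x                  ≈⟨ x≤u⊕v ⟨
    x ∧ (u ⊕ v)        ≈⟨ ∧-distribˡ-⊕ x u v ⟩
    (x ∧ u) ⊕ (x ∧ v)  ≈⟨ ⊕-cong x≤u x≤v ⟩
    x ⊕ x              ≈⟨ ⊕-inverseʳ x ⟩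
    ⊥                  ∎

  ⊕-nonzero : ∀ {x y} → ¬ x ≈ y → ¬ x ⊕ y ≈ ⊥
  ⊕-nonzero x≉y x⊕y≈⊥ = x≉y (inverseˡ-unique _ _ x⊕y≈⊥)

  nonzero-lowerBound≈⊥ : ∀ {x a b c} → (∀ u → ¬ u ≈ ⊥ → x ≤ u) →
                          ¬ a ≈ b → ¬ a ≈ c → ¬ b ≈ c → x ≈ ⊥
  nonzero-lowerBound≈⊥ {x} {a} {b} {c} below a≉b a≉c b≉c =
    ≤⊕⇒≈⊥ (below _ (⊕-nonzero a≉b)) (below _ (⊕-nonzero a≉c))
      (below _ (⊕-nonzero λ a⊕b≈a⊕c → b≉c (begin
        b                ≈⟨ \\-leftDividesˡ a b ⟨
        a ⊕ (a ⊕ b)      ≈⟨ ⊕-cong refl a⊕b≈a⊕c ⟩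
        a ⊕ (a ⊕ c)      ≈⟨ \\-leftDividesˡ a c ⟩
        c                ∎)))

module BetweennessAlgebraProperties {c ℓ} (A : BetweennessAlgebra c ℓ) where
  open BetweennessAlgebra A
  open BooleanAlgebraProperties boolAlg
    using (∧-identityˡ; ∧-zeroˡ; ∧-zeroʳ; ∨-zeroˡ; ∨-identityˡ; ¬-involutive; ¬⊥≈⊤; ¬⊤≈⊥)
  open BooleanAlgebraOrder boolAlg
    using (≤-trans; ≈∧⇒≤; ∧-≈⊥⇒≤; ≤-⇒∧≈⊥; ⊤≈⊥⇒≈; nonzero-lowerBound≈⊥)
  open SetoidReasoning setoid

  g-⊤ˡ-least : ∀ x y → g ⊤ y ≤ g x y
  g-⊤ˡ-least x y = ≈∧⇒≤ (trans (g-cong (sym (∨-complementʳ x)) refl) (g-mulˡ x (- x) y))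

  g-⊤ʳ-least : ∀ x y → g x ⊤ ≤ g x y
  g-⊤ʳ-least x y = ≈∧⇒≤ (trans (g-cong refl (sym (∨-complementʳ y))) (g-mulʳ x y (- y)))

  B5-¬ : ∀ x y → f x (g x y ∧ - y) ≤ (- y)
  B5-¬ x y = begin
    f x (g x y ∧ - y) ∧ - y          ≈⟨ ∧-cong (f-cong refl (∧-cong (g-cong refl ¬¬y≈y) refl)) refl ⟨
    f x (g x (- - y) ∧ - y) ∧ - y    ≈⟨ B5 x (- y) ⟩
    f x (g x (- - y) ∧ - y)          ≈⟨ f-cong refl (∧-cong (g-cong refl ¬¬y≈y) refl) ⟩
    f x (g x y ∧ - y)                ∎
    where ¬¬y≈y = ¬-involutive y

  B4-⊥ : ∀ {x y} z → x ∧ f x y ≈ ⊥ → y ∧ f x z ≈ ⊥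
  B4-⊥ {x} {y} z x∧fxy≈⊥ = begin
    y ∧ f x z                          ≈⟨ B4 x y z ⟨
    (y ∧ f x z) ∧ f (x ∧ f x y) z      ≈⟨ ∧-cong refl (trans (f-cong x∧fxy≈⊥ refl) (f-0ˡ z)) ⟩
    (y ∧ f x z) ∧ ⊥                    ≈⟨ ∧-zeroʳ (y ∧ f x z) ⟩
    ⊥                                  ∎

  g-diag≤ : ∀ {u} → ¬ u ≈ ⊥ → g u u ≤ u
  g-diag≤ {u} u≉⊥ = ∧-≈⊥⇒≤ (begin
    g u u ∧ - u                  ≈⟨ ∧-cong (B6 u u u≉⊥ u≉⊥) refl ⟨
    (g u u ∧ f u u) ∧ - u        ≈⟨ ∧-assoc (g u u) (f u u) (- u) ⟩
    g u u ∧ (f u u ∧ - u)        ≈⟨ ∧-cong refl (∧-comm (f u u) (- u)) ⟩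
    g u u ∧ (- u ∧ f u u)        ≈⟨ ∧-assoc (g u u) (- u) (f u u) ⟨
    (g u u ∧ - u) ∧ f u u        ≈⟨ B4-⊥ u (≤-⇒∧≈⊥ (B5-¬ u u)) ⟩
    ⊥                            ∎)

  g⊤⊤≤nonzero : ∀ u → ¬ u ≈ ⊥ → g ⊤ ⊤ ≤ u
  g⊤⊤≤nonzero u u≉⊥ = ≤-trans (g-⊤ˡ-least u ⊤) (≤-trans (g-⊤ʳ-least u u) (g-diag≤ u≉⊥))

  f⊤⊤≈⊤ : f ⊤ ⊤ ≈ ⊤
  f⊤⊤≈⊤ = trans (sym (∧-identityˡ (f ⊤ ⊤))) (B1 ⊤)

  distinct⇒g⊤⊤≈⊥ : ∀ {a b c} → ¬ a ≈ b → ¬ a ≈ c → ¬ b ≈ c → g ⊤ ⊤ ≈ ⊥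
  distinct⇒g⊤⊤≈⊥ = nonzero-lowerBound≈⊥ g⊤⊤≤nonzero

  distinct⇒⊤≉⊥ : ∀ {a b} → ¬ a ≈ b → ¬ ⊤ ≈ ⊥
  distinct⇒⊤≉⊥ a≉b ⊤≈⊥ = a≉b (⊤≈⊥⇒≈ ⊤≈⊥ _ _)

  bool-embedding : ¬ ⊤ ≈ ⊥ → g ⊤ ⊤ ≈ ⊥ → TwoElementSubalgebra A
  bool-embedding ⊤≉⊥ g⊤⊤≈⊥ = record
    { h = h ; inj = inj ; h-∨ = h-∨ ; h-∧ = h-∧ ; h-¬ = h-¬ ; h-0 = refl ; h-1 = refl
    ; h-f = h-f ; h-g = h-g }
    where
    h : Bool → Carrier
    h true  = ⊤
    h false = ⊥

    inj : ∀ x y → h x ≈ h y → x ≡ y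
    inj true  true  _   = ≡-refl
    inj false false _   = ≡-refl
    inj true  false ⊤≈⊥ = ⊥-elim (⊤≉⊥ ⊤≈⊥)
    inj false true  ⊥≈⊤ = ⊥-elim (⊤≉⊥ (sym ⊥≈⊤))

    h-∨ : ∀ x y → h (x ∨ᵇ y) ≈ h x ∨ h y
    h-∨ true  y = sym (∨-zeroˡ (h y))
    h-∨ false y = sym (∨-identityˡ (h y))

    h-∧ : ∀ x y → h (x ∧ᵇ y) ≈ h x ∧ h y
    h-∧ true  y = sym (∧-identityˡ (h y))
    h-∧ false y = sym (∧-zeroˡ (h y))

    h-¬ : ∀ x → h (not x) ≈ - h x
    h-¬ true  = sym ¬⊤≈⊥
    h-¬ false = sym ¬⊥≈⊤

    h-f : ∀ x y → h (f₁ x y) ≈ f (h x) (h y)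
    h-f true  true  = sym f⊤⊤≈⊤
    h-f true  false = sym (f-0ʳ ⊤)
    h-f false y     = sym (f-0ˡ (h y))

    h-g : ∀ x y → h (g₁ x y) ≈ g (h x) (h y)
    h-g true  true  = sym g⊤⊤≈⊥
    h-g true  false = sym (g-0ʳ ⊤)
    h-g false y     = sym (g-0ˡ (h y))

theorem8p3 : ∀ {c ℓ} (A : BetweennessAlgebra c ℓ) → AtLeastFour A → TwoElementSubalgebra A
theorem8p3 A (_ , _ , _ , _ , a≉b , a≉c , _ , b≉c , _) =
  bool-embedding (distinct⇒⊤≉⊥ a≉b) (distinct⇒g⊤⊤≈⊥ a≉b a≉c b≉c)
  where open BetweennessAlgebraProperties A
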